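{- Let $N\ge 1$. For $\varepsilon\in\{1,-1\}$ and $k\ge 0$ put $\alpha_N^{(k)}=Q_N\sigma_{2N}(1)^kQ_N^\top$ and $\beta_N^{(k)}=Q_N\sigma_{2N}(-1)^kQ_N^\top$, and let $\alpha_N=\alpha_N^{(1)}$, $\beta_N=\beta_N^{(1)}$. Let $\gamma^{(0)}=2I$ (infinite identity) and for $k\ge 1$ let $\gamma^{(k)}$ be the infinite matrix with rows and columns indexed by $\mathbb{Z}_{\ge 0}$ whose $(i,j)$ entry is $1$ if $|i-j|=k$ or $i+j=k-1$ and $0$ otherwise; put $\gamma=\gamma^{(1)}$. Let $\delta$ be any one of $\alpha_N$, $\beta_N$, $\gamma$. Then $\delta^{(1)}=\delta$, $\delta^{(0)}=2I$, and for every $k\ge 2$, $$\delta^{(k)}=\delta\cdot\delta^{(k-1)}-\delta^{(k-2)}.$$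
   Context: $J_N$ is the $N\times N$ exchange matrix (ones on the antidiagonal, zeros elsewhere), $I_N$ the identity, and $Q_N=\begin{pmatrix}J_N & I_N\end{pmatrix}$ is the $N\times 2N$ block matrix. For a scalar $\varepsilon$, $\sigma_{2N}(\varepsilon)$ is the $2N\times 2N$ matrix (indices $0,\dots,2N-1$) with $(i,j)$ entry $1$ if $i=j+1$, $\varepsilon$ if $(i,j)=(0,2N-1)$, and $0$ otherwise. Products of the infinite matrices $\gamma^{(k)}$ are well-defined since every row and column has finitely many nonzero entries. -}

module Defs where

open import Data.Nat as ℕ using (ℕ; zero; suc; _≤_; _∸_; ∣_-_∣; z≤n; s≤s)
open import Data.Nat.Properties using (+-suc)
open import Data.Integer as ℤ using (ℤ; 0ℤ; 1ℤ; +_)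
open import Data.Fin using (Fin; toℕ; splitAt)
open import Data.Empty using (⊥; ⊥-elim)
open import Data.Sum using (inj₁; inj₂)
open import Relation.Nullary using (yes; no)
open import Relation.Binary.PropositionalEquality using (_≡_; refl)

Mat : ℕ → ℕ → Set
Mat m n = Fin m → Fin n → ℤ

sumFin : (n : ℕ) → (Fin n → ℤ) → ℤ
sumFin zero    f = 0ℤ
sumFin (suc n) f = f Fin.zero ℤ.+ sumFin n (λ i → f (Fin.suc i))

infixl 7 _·_
_·_ : ∀ {m n p} → Mat m n → Mat n p → Mat m p
_·_ {n = n} A B i j = sumFin n (λ l → A i l ℤ.* B l j)

_ᵀ : ∀ {m n} → Mat m n → Mat n m
(A ᵀ) i j = A j i

idMat : ∀ {n} → Mat n n
idMat i j with toℕ i ℕ.≟ toℕ j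
... | yes _ = 1ℤ
... | no  _ = 0ℤ

twoI : ∀ {n} → Mat n n
twoI i j with toℕ i ℕ.≟ toℕ j
... | yes _ = + 2
... | no  _ = 0ℤ

pow : ∀ {n} → Mat n n → ℕ → Mat n n
pow M zero    = idMat
pow M (suc k) = M · pow M k

J : (N : ℕ) → Mat N N
J N i j with (toℕ i ℕ.+ toℕ j) ℕ.≟ (N ∸ 1)
... | yes _ = 1ℤ
... | no  _ = 0ℤ

Q : (N : ℕ) → Mat N (N ℕ.+ N)
Q N i j with splitAt N j
... | inj₁ j′ = J N i j′
... | inj₂ j′ = idMat i j′

σ : (N : ℕ) → ℤ → Mat (N ℕ.+ N) (N ℕ.+ N)
σ N ε i j with toℕ i ℕ.≟ suc (toℕ j)
... | yes _ = 1ℤ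
... | no  _ with toℕ i ℕ.≟ 0 | toℕ j ℕ.≟ ((N ℕ.+ N) ∸ 1)
...   | yes _ | yes _ = ε
...   | _     | _     = 0ℤ

alphaK : (N k : ℕ) → Mat N N
alphaK N k = Q N · pow (σ N 1ℤ) k · (Q N ᵀ)

betaK : (N k : ℕ) → Mat N N
betaK N k = Q N · pow (σ N (ℤ.- 1ℤ)) k · (Q N ᵀ)

alpha : (N : ℕ) → Mat N N
alpha N = alphaK N 1

beta : (N : ℕ) → Mat N N
beta N = betaK N 1

IMat : Set
IMat = ℕ → ℕ → ℤ

twoIinf : IMat
twoIinf i j with i ℕ.≟ j
... | yes _ = + 2
... | no  _ = 0ℤ

gammaK : ℕ → IMat
gammaK zero    = twoIinf
gammaK (suc k) i j with ∣ i - j ∣ ℕ.≟ suc k | (i ℕ.+ j) ℕ.≟ k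
... | yes _ | _     = 1ℤ
... | no  _ | yes _ = 1ℤ
... | no  _ | no  _ = 0ℤ

record RowFinite : Set where
  field
    entry  : IMat
    bound  : ℕ → ℕ
    vanish : ∀ i l → bound i ≤ l → entry i l ≡ 0ℤ
open RowFinite public

sumUpTo : ℕ → (ℕ → ℤ) → ℤ
sumUpTo zero    f = 0ℤ
sumUpTo (suc n) f = sumUpTo n f ℤ.+ f n

-- product (A B)(i,j) = Σ_l A(i,l) B(l,j), a finite sum since A is row-finite
imul : RowFinite → IMat → IMat
imul A B i j = sumUpTo (bound A i) (λ l → entry A i l ℤ.* B l j)

private
  dist≢1 : ∀ i l → suc (suc i) ≤ l → ∣ i - l ∣ ≡ 1 → ⊥
  dist≢1 zero    (suc zero) (s≤s ()) _
  dist≢1 zero    (suc (suc l)) _ ()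
  dist≢1 (suc i) (suc l) (s≤s p) e = dist≢1 i l p e

  sum≢0 : ∀ i l → suc (suc i) ≤ l → (i ℕ.+ l) ≡ 0 → ⊥
  sum≢0 i (suc l) _ e rewrite +-suc i l with e
  ... | ()

  gammaVanish : ∀ i l → suc (suc i) ≤ l → gammaK 1 i l ≡ 0ℤ
  gammaVanish i l p with ∣ i - l ∣ ℕ.≟ 1 | (i ℕ.+ l) ℕ.≟ 0
  ... | yes e | _     = ⊥-elim (dist≢1 i l p e)
  ... | no  _ | yes e = ⊥-elim (sum≢0 i l p e)
  ... | no  _ | no  _ = refl

-- γ = γ^(1), row i supported in columns ≤ i+1
gamma : RowFinite
gamma = record { entry = gammaK 1 ; bound = λ i → suc (suc i) ; vanish = gammaVanish }

module Submission where

-- Put S = σ_{2N}(ε) with ε² = 1, Q = Q_N and R = J_{2N}.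
-- Column a of Q is the unit vector at col a, and col identifies exactly the
-- columns a and opposite a (the reversal of a in Fin 2N).  Hence
--   Qᵀ Q = I + R,   Q R = Q,   Q Qᵀ = 2I,
-- while S R S = R because reversal conjugates the twisted shift S to its
-- inverse when ε² = 1.  Pure matrix algebra (key-identity) turns the first
-- two identities and S R S = R into (Q S Qᵀ)(Q S) = Q S S + Q, and multiplying
-- by S^k Qᵀ on the right gives the recurrence for A k = Q S^k Qᵀ
-- (chebyshev-recurrence).
--
-- Infinite case.  γ^(k)(i,j) = [i = k+j] + [j = k+i] + [i+j+1 = k] for all k
-- (gammaK-formula); row 0 of γ is e₀ + e₁ and row i+1 is eᵢ + eᵢ₊₂, so the
-- recurrence becomes a cancellation between Kronecker deltas.

open import Defs
open import Data.Nat using (ℕ; _≤_; _∸_)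
open import Data.Integer using (_-_)
open import Data.Fin using (Fin)
open import Data.Product using (_×_; _,_)
open import Relation.Binary.PropositionalEquality using (_≡_)

open import Data.Bool using (if_then_else_)
open import Data.Nat as ℕ using (zero; suc; _<_; ∣_-_∣; _≡ᵇ_; s≤s; z≤n)
import Data.Nat.Properties as ℕP
open import Data.Integer as ℤ using (ℤ; 0ℤ; 1ℤ; _+_; _*_)
import Data.Integer.Properties as ℤP
open import Data.Integer.Solver using (module +-*-Solver)
open import Data.Sum using (_⊎_; inj₁; inj₂; [_,_]′)
open import Data.Fin as Fin using (zero; suc; toℕ; opposite; inject₁; fromℕ; splitAt; _↑ˡ_; _↑ʳ_)
import Data.Fin.Properties as FinP
open import Algebra.Properties.Semiring.Sum ℤP.+-*-semiring
  using (sum; sum-cong-≗; sum-replicate-zero; ∑-distrib-+; ∑-comm; *-distribˡ-sum; *-distribʳ-sum)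
open import Relation.Binary.Bundles using (Setoid)
import Relation.Binary.Reasoning.Setoid as SetoidReasoning
open import Relation.Nullary using (yes; no; contradiction)
open import Relation.Binary.PropositionalEquality
  using (refl; sym; trans; cong; cong₂; subst; _≢_; module ≡-Reasoning)
open import Function using (id)

open +-*-Solver using (solve; _:+_; _:-_; _:=_; con)

-- Kronecker delta on ℕ, valued in ℤ.  It is defined through _≡ᵇ_ so that
-- δ (suc x) (suc y) reduces to δ x y.
δ : ℕ → ℕ → ℤ
δ x y = if x ≡ᵇ y then 1ℤ else 0ℤ

δ-refl : ∀ x → δ x x ≡ 1ℤ
δ-refl zero    = refl
δ-refl (suc x) = δ-refl x

δ-≢ : ∀ {x y} → x ≢ y → δ x y ≡ 0ℤ
δ-≢ {zero}  {zero}  x≢y = contradiction refl x≢y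
δ-≢ {zero}  {suc y} x≢y = refl
δ-≢ {suc x} {zero}  x≢y = refl
δ-≢ {suc x} {suc y} x≢y = δ-≢ (λ x≡y → x≢y (cong suc x≡y))

δ-≡ : ∀ {x y} → x ≡ y → δ x y ≡ 1ℤ
δ-≡ {x} refl = δ-refl x

δ-cong : ∀ {x y x′ y′} → (x ≡ y → x′ ≡ y′) → (x′ ≡ y′ → x ≡ y) → δ x y ≡ δ x′ y′
δ-cong {x} {y} to from with x ℕ.≟ y
... | yes x≡y = trans (δ-≡ x≡y) (sym (δ-≡ (to x≡y)))
... | no  x≢y = trans (δ-≢ x≢y) (sym (δ-≢ (λ e → x≢y (from e))))

δ-sym : ∀ x y → δ x y ≡ δ y x
δ-sym x y = δ-cong {x} {y} {y} {x} sym sym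

-- Equality of finite matrices is entrywise equality; a record, so that the
-- two matrices can be recovered by unification.
infix 4 _≈_
record _≈_ {m n} (A B : Mat m n) : Set where
  field at : ∀ i j → A i j ≡ B i j
open _≈_ public

infixl 6 _⊕_
_⊕_ : ∀ {m n} → Mat m n → Mat m n → Mat m n
(A ⊕ B) i j = A i j + B i j

≈-refl : ∀ {m n} {A : Mat m n} → A ≈ A
≈-refl .at i j = refl

≈-sym : ∀ {m n} {A B : Mat m n} → A ≈ B → B ≈ A
≈-sym A≈B .at i j = sym (A≈B .at i j)

≈-setoid : ℕ → ℕ → Setoid _ _
≈-setoid m n = record
  { Carrier       = Mat m n
  ; _≈_           = _≈_
  ; isEquivalence = record
    { refl  = ≈-refl
    ; sym   = ≈-sym
    ; trans = λ A≈B B≈C → record { at = λ i j → trans (A≈B .at i j) (B≈C .at i j) }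
    }
  }

module ≈-Reasoning (m n : ℕ) = SetoidReasoning (≈-setoid m n)

sumFin-sum : ∀ n (f : Fin n → ℤ) → sumFin n f ≡ sum f
sumFin-sum zero    f = refl
sumFin-sum (suc n) f = cong (f zero +_) (sumFin-sum n (λ i → f (suc i)))

sumFin-cong : ∀ {n} {f g : Fin n → ℤ} → (∀ l → f l ≡ g l) → sumFin n f ≡ sumFin n g
sumFin-cong {n} {f} {g} f≗g = trans (sumFin-sum n f) (trans (sum-cong-≗ f≗g) (sym (sumFin-sum n g)))

·-sum : ∀ {m n p} (A : Mat m n) (B : Mat n p) i j → (A · B) i j ≡ sum (λ l → A i l * B l j)
·-sum {n = n} A B i j = sumFin-sum n (λ l → A i l * B l j)

·-assoc : ∀ {m n p q} (A : Mat m n) (B : Mat n p) (C : Mat p q) → (A · B) · C ≈ A · (B · C)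
·-assoc A B C .at i j = begin
  ((A · B) · C) i j
    ≡⟨ ·-sum (A · B) C i j ⟩
  sum (λ l → (A · B) i l * C l j)
    ≡⟨ sum-cong-≗ (λ l → cong (_* C l j) (·-sum A B i l)) ⟩
  sum (λ l → sum (λ k → A i k * B k l) * C l j)
    ≡⟨ sum-cong-≗ (λ l → trans (*-distribʳ-sum (C l j) (λ k → A i k * B k l)) (sum-cong-≗ (λ k → ℤP.*-assoc (A i k) (B k l) (C l j)))) ⟩
  sum (λ l → sum (λ k → A i k * (B k l * C l j)))
    ≡⟨ ∑-comm (λ l k → A i k * (B k l * C l j)) ⟩
  sum (λ k → sum (λ l → A i k * (B k l * C l j)))
    ≡⟨ sum-cong-≗ (λ k → sym (trans (cong (A i k *_) (·-sum B C k j)) (*-distribˡ-sum (A i k) (λ l → B k l * C l j)))) ⟩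
  sum (λ k → A i k * (B · C) k j)
    ≡⟨ sym (·-sum A (B · C) i j) ⟩
  (A · (B · C)) i j ∎
  where open ≡-Reasoning

-- Congruence of the matrix operations (the fixed operand is explicit, since
-- matrices are functions and cannot be inferred by unification).
·-congˡ : ∀ {m n p} {A A′ : Mat m n} (B : Mat n p) → A ≈ A′ → A · B ≈ A′ · B
·-congˡ B A≈A′ .at i j = sumFin-cong (λ l → cong (_* B l j) (A≈A′ .at i l))

·-congʳ : ∀ {m n p} (A : Mat m n) {B B′ : Mat n p} → B ≈ B′ → A · B ≈ A · B′
·-congʳ A B≈B′ .at i j = sumFin-cong (λ l → cong (A i l *_) (B≈B′ .at l j))

⊕-congˡ : ∀ {m n} {A A′ : Mat m n} (B : Mat m n) → A ≈ A′ → A ⊕ B ≈ A′ ⊕ B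
⊕-congˡ B A≈A′ .at i j = cong (_+ B i j) (A≈A′ .at i j)

⊕-congʳ : ∀ {m n} (A : Mat m n) {B B′ : Mat m n} → B ≈ B′ → A ⊕ B ≈ A ⊕ B′
⊕-congʳ A B≈B′ .at i j = cong (A i j +_) (B≈B′ .at i j)

·-distribˡ : ∀ {m n p} (A : Mat m n) (B C : Mat n p) → A · (B ⊕ C) ≈ A · B ⊕ A · C
·-distribˡ A B C .at i j = begin
  (A · (B ⊕ C)) i j                               ≡⟨ ·-sum A (B ⊕ C) i j ⟩
  sum (λ l → A i l * (B l j + C l j))             ≡⟨ sum-cong-≗ (λ l → ℤP.*-distribˡ-+ (A i l) (B l j) (C l j)) ⟩
  sum (λ l → A i l * B l j + A i l * C l j)       ≡⟨ ∑-distrib-+ (λ l → A i l * B l j) (λ l → A i l * C l j) ⟩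
  sum (λ l → A i l * B l j) + sum (λ l → A i l * C l j)
                                                  ≡⟨ sym (cong₂ _+_ (·-sum A B i j) (·-sum A C i j)) ⟩
  (A · B ⊕ A · C) i j                             ∎
  where open ≡-Reasoning

·-distribʳ : ∀ {m n p} (A B : Mat m n) (C : Mat n p) → (A ⊕ B) · C ≈ A · C ⊕ B · C
·-distribʳ A B C .at i j = begin
  ((A ⊕ B) · C) i j                               ≡⟨ ·-sum (A ⊕ B) C i j ⟩
  sum (λ l → (A i l + B i l) * C l j)             ≡⟨ sum-cong-≗ (λ l → ℤP.*-distribʳ-+ (C l j) (A i l) (B i l)) ⟩
  sum (λ l → A i l * C l j + B i l * C l j)       ≡⟨ ∑-distrib-+ (λ l → A i l * C l j) (λ l → B i l * C l j) ⟩
  sum (λ l → A i l * C l j) + sum (λ l → B i l * C l j)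
                                                  ≡⟨ sym (cong₂ _+_ (·-sum A C i j) (·-sum B C i j)) ⟩
  (A · C ⊕ B · C) i j                             ∎
  where open ≡-Reasoning

idMat-δ : ∀ {n} (i j : Fin n) → idMat i j ≡ δ (toℕ i) (toℕ j)
idMat-δ i j with toℕ i ℕ.≟ toℕ j
... | yes i≡j = sym (δ-≡ i≡j)
... | no  i≢j = sym (δ-≢ i≢j)

idMat-cong : ∀ {m n} {i j : Fin m} {i′ j′ : Fin n} →
             (i ≡ j → i′ ≡ j′) → (i′ ≡ j′ → i ≡ j) → idMat i j ≡ idMat i′ j′
idMat-cong {i = i} {j} {i′} {j′} to from = begin
  idMat i j              ≡⟨ idMat-δ i j ⟩
  δ (toℕ i) (toℕ j)      ≡⟨ δ-cong (λ e → cong toℕ (to (FinP.toℕ-injective e)))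
                                   (λ e → cong toℕ (from (FinP.toℕ-injective e))) ⟩
  δ (toℕ i′) (toℕ j′)    ≡⟨ sym (idMat-δ i′ j′) ⟩
  idMat i′ j′            ∎
  where open ≡-Reasoning

idMat-refl : ∀ {n} (i : Fin n) → idMat i i ≡ 1ℤ
idMat-refl i = trans (idMat-δ i i) (δ-refl (toℕ i))

idMat-≢ : ∀ {n} {i j : Fin n} → i ≢ j → idMat i j ≡ 0ℤ
idMat-≢ {i = i} {j} i≢j = trans (idMat-δ i j) (δ-≢ (λ e → i≢j (FinP.toℕ-injective e)))

idMat-sym : ∀ {n} (i j : Fin n) → idMat i j ≡ idMat j i
idMat-sym i j = idMat-cong sym sym

sum-idMat : ∀ {n} (c : Fin n) (f : Fin n → ℤ) → sum (λ l → idMat c l * f l) ≡ f c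
sum-idMat c f = trans (sum-cong-≗ (λ l → cong (_* f l) (idMat-δ c l))) (sum-δ c f)
  where
  sum-δ : ∀ {n} (c : Fin n) (f : Fin n → ℤ) → sum (λ l → δ (toℕ c) (toℕ l) * f l) ≡ f c
  sum-δ {suc n} zero f = begin
    1ℤ * f zero + sum (λ l → 0ℤ * f (suc l))
      ≡⟨ cong₂ _+_ (ℤP.*-identityˡ (f zero)) (trans (sum-cong-≗ (λ l → ℤP.*-zeroˡ (f (suc l)))) (sum-replicate-zero n)) ⟩
    f zero + 0ℤ
      ≡⟨ ℤP.+-identityʳ (f zero) ⟩
    f zero ∎
    where open ≡-Reasoning
  sum-δ (suc c) f = begin
    0ℤ * f zero + sum (λ l → δ (toℕ c) (toℕ l) * f (suc l))
      ≡⟨ cong₂ _+_ (ℤP.*-zeroˡ (f zero)) (sum-δ c (λ l → f (suc l))) ⟩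
    0ℤ + f (suc c)
      ≡⟨ ℤP.+-identityˡ (f (suc c)) ⟩
    f (suc c) ∎
    where open ≡-Reasoning

row-select : ∀ {m n p} (A : Mat m n) (X : Mat n p) i c e →
             (∀ l → A i l ≡ e * idMat c l) → ∀ j → (A · X) i j ≡ e * X c j
row-select A X i c e row j = begin
  (A · X) i j                            ≡⟨ ·-sum A X i j ⟩
  sum (λ l → A i l * X l j)              ≡⟨ sum-cong-≗ (λ l → trans (cong (_* X l j) (row l)) (ℤP.*-assoc e (idMat c l) (X l j))) ⟩
  sum (λ l → e * (idMat c l * X l j))    ≡⟨ sym (*-distribˡ-sum e (λ l → idMat c l * X l j)) ⟩
  e * sum (λ l → idMat c l * X l j)      ≡⟨ cong (e *_) (sum-idMat c (λ l → X l j)) ⟩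
  e * X c j                              ∎
  where open ≡-Reasoning

row-select₁ : ∀ {m n p} (A : Mat m n) (X : Mat n p) i c →
              (∀ l → A i l ≡ idMat c l) → ∀ j → (A · X) i j ≡ X c j
row-select₁ A X i c row j =
  trans (row-select A X i c 1ℤ (λ l → trans (row l) (sym (ℤP.*-identityˡ (idMat c l)))) j) (ℤP.*-identityˡ (X c j))

row-select₂ : ∀ {m n p} (A : Mat m n) (X : Mat n p) i c d →
              (∀ l → A i l ≡ idMat c l + idMat d l) → ∀ j → (A · X) i j ≡ X c j + X d j
row-select₂ A X i c d row j = begin
  (A · X) i j
    ≡⟨ ·-sum A X i j ⟩
  sum (λ l → A i l * X l j)
    ≡⟨ sum-cong-≗ (λ l → trans (cong (_* X l j) (row l)) (ℤP.*-distribʳ-+ (X l j) (idMat c l) (idMat d l))) ⟩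
  sum (λ l → idMat c l * X l j + idMat d l * X l j)
    ≡⟨ ∑-distrib-+ (λ l → idMat c l * X l j) (λ l → idMat d l * X l j) ⟩
  sum (λ l → idMat c l * X l j) + sum (λ l → idMat d l * X l j)
    ≡⟨ cong₂ _+_ (sum-idMat c (λ l → X l j)) (sum-idMat d (λ l → X l j)) ⟩
  X c j + X d j ∎
  where open ≡-Reasoning

column-select : ∀ {m n p} (X : Mat m n) (B : Mat n p) j c →
                (∀ l → B l j ≡ idMat c l) → ∀ i → (X · B) i j ≡ X i c
column-select X B j c column i = begin
  (X · B) i j                      ≡⟨ ·-sum X B i j ⟩
  sum (λ l → X i l * B l j)        ≡⟨ sum-cong-≗ (λ l → trans (ℤP.*-comm (X i l) (B l j)) (cong (_* X i l) (column l))) ⟩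
  sum (λ l → idMat c l * X i l)    ≡⟨ sum-idMat c (X i) ⟩
  X i c                            ∎
  where open ≡-Reasoning

·-identityˡ : ∀ {m n} (A : Mat m n) → idMat · A ≈ A
·-identityˡ A .at i = row-select₁ idMat A i i (λ l → refl)

·-identityʳ : ∀ {m n} (A : Mat m n) → A · idMat ≈ A
·-identityʳ A .at i j = column-select A idMat j j (λ l → idMat-sym l j) i

key-identity : ∀ {n m} (Q : Mat n m) (B : Mat m n) (S R : Mat m m) →
               B · Q ≈ idMat ⊕ R → S · (R · S) ≈ R → Q · R ≈ Q →
               ((Q · S) · B) · (Q · S) ≈ (Q · S) · S ⊕ Q
key-identity {n} {m} Q B S R BQ≈I+R SRS≈R QR≈Q = begin
  ((Q · S) · B) · (Q · S)           ≈⟨ ·-assoc (Q · S) B (Q · S) ⟩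
  (Q · S) · (B · (Q · S))           ≈⟨ ·-congʳ (Q · S) (≈-sym (·-assoc B Q S)) ⟩
  (Q · S) · ((B · Q) · S)           ≈⟨ ·-congʳ (Q · S) (·-congˡ S BQ≈I+R) ⟩
  (Q · S) · ((idMat ⊕ R) · S)       ≈⟨ ·-congʳ (Q · S) (·-distribʳ idMat R S) ⟩
  (Q · S) · (idMat · S ⊕ R · S)     ≈⟨ ·-congʳ (Q · S) (⊕-congˡ (R · S) (·-identityˡ S)) ⟩
  (Q · S) · (S ⊕ R · S)             ≈⟨ ·-distribˡ (Q · S) S (R · S) ⟩
  (Q · S) · S ⊕ (Q · S) · (R · S)   ≈⟨ ⊕-congʳ ((Q · S) · S) (·-assoc Q S (R · S)) ⟩
  (Q · S) · S ⊕ Q · (S · (R · S))   ≈⟨ ⊕-congʳ ((Q · S) · S) (·-congʳ Q SRS≈R) ⟩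
  (Q · S) · S ⊕ Q · R               ≈⟨ ⊕-congʳ ((Q · S) · S) QR≈Q ⟩
  (Q · S) · S ⊕ Q                   ∎
  where open ≈-Reasoning n m

chebyshev-recurrence : ∀ {n m} (Q : Mat n m) (B : Mat m n) (S : Mat m m) →
  ((Q · S) · B) · (Q · S) ≈ (Q · S) · S ⊕ Q →
  ∀ k → ((Q · S) · B) · ((Q · pow S (1 ℕ.+ k)) · B) ≈ (Q · pow S (2 ℕ.+ k)) · B ⊕ (Q · pow S k) · B
chebyshev-recurrence {n} {m} Q B S key k = begin
  ((Q · S) · B) · ((Q · (S · P)) · B)       ≈⟨ ·-congʳ ((Q · S) · B) (·-congˡ B (≈-sym (·-assoc Q S P))) ⟩
  ((Q · S) · B) · (((Q · S) · P) · B)       ≈⟨ ≈-sym (·-assoc ((Q · S) · B) ((Q · S) · P) B) ⟩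
  (((Q · S) · B) · ((Q · S) · P)) · B       ≈⟨ ·-congˡ B (≈-sym (·-assoc ((Q · S) · B) (Q · S) P)) ⟩
  ((((Q · S) · B) · (Q · S)) · P) · B       ≈⟨ ·-congˡ B (·-congˡ P key) ⟩
  (((Q · S) · S ⊕ Q) · P) · B               ≈⟨ ·-congˡ B (·-distribʳ ((Q · S) · S) Q P) ⟩
  (((Q · S) · S) · P ⊕ Q · P) · B           ≈⟨ ·-distribʳ (((Q · S) · S) · P) (Q · P) B ⟩
  (((Q · S) · S) · P) · B ⊕ (Q · P) · B     ≈⟨ ⊕-congˡ ((Q · P) · B) (·-congˡ B reassociate) ⟩
  (Q · (S · (S · P))) · B ⊕ (Q · P) · B     ∎
  where
  P : Mat m m
  P = pow S k
  open ≈-Reasoning n n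
  reassociate : ((Q · S) · S) · P ≈ Q · (S · (S · P))
  reassociate .at i j = trans (·-assoc (Q · S) S P .at i j) (·-assoc Q S (S · P) .at i j)

data Block (m n : ℕ) : Fin (m ℕ.+ n) → Set where
  left  : ∀ l → Block m n (l ↑ˡ n)
  right : ∀ r → Block m n (m ↑ʳ r)

block : ∀ m n a → Block m n a
block m n a with splitAt m a in eq
... | inj₁ l = subst (Block m n) (FinP.splitAt⁻¹-↑ˡ eq) (left l)
... | inj₂ r = subst (Block m n) (FinP.splitAt⁻¹-↑ʳ eq) (right r)

↑ˡ≢↑ʳ : ∀ {m n} (l : Fin m) (r : Fin n) → l ↑ˡ n ≢ m ↑ʳ r
↑ˡ≢↑ʳ {m} {n} l r eq = ℕP.<⇒≢ (ℕP.≤-trans (FinP.toℕ<n l) (ℕP.m≤m+n m (toℕ r))) (begin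
  toℕ l            ≡⟨ sym (FinP.toℕ-↑ˡ l n) ⟩
  toℕ (l ↑ˡ n)     ≡⟨ cong toℕ eq ⟩
  toℕ (m ↑ʳ r)     ≡⟨ FinP.toℕ-↑ʳ m r ⟩
  m ℕ.+ toℕ r      ∎)
  where open ≡-Reasoning

opposite-injective : ∀ {n} {i j : Fin n} → opposite i ≡ opposite j → i ≡ j
opposite-injective {i = i} {j} eq =
  trans (sym (FinP.opposite-involutive i)) (trans (cong opposite eq) (FinP.opposite-involutive j))

opposite-↑ˡ : ∀ {N} (l : Fin N) → opposite (l ↑ˡ N) ≡ N ↑ʳ opposite l
opposite-↑ˡ {N} l = FinP.toℕ-injective (begin
  toℕ (opposite (l ↑ˡ N))          ≡⟨ FinP.opposite-prop (l ↑ˡ N) ⟩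
  (N ℕ.+ N) ∸ suc (toℕ (l ↑ˡ N))   ≡⟨ cong (λ x → (N ℕ.+ N) ∸ suc x) (FinP.toℕ-↑ˡ l N) ⟩
  (N ℕ.+ N) ∸ suc (toℕ l)          ≡⟨ ℕP.+-∸-assoc N (FinP.toℕ<n l) ⟩
  N ℕ.+ (N ∸ suc (toℕ l))          ≡⟨ cong (N ℕ.+_) (sym (FinP.opposite-prop l)) ⟩
  N ℕ.+ toℕ (opposite l)           ≡⟨ sym (FinP.toℕ-↑ʳ N (opposite l)) ⟩
  toℕ (N ↑ʳ opposite l)            ∎)
  where open ≡-Reasoning

opposite-↑ʳ : ∀ {N} (r : Fin N) → opposite (N ↑ʳ r) ≡ opposite r ↑ˡ N
opposite-↑ʳ {N} r = begin
  opposite (N ↑ʳ r)                         ≡⟨ cong (λ x → opposite (N ↑ʳ x)) (sym (FinP.opposite-involutive r)) ⟩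
  opposite (N ↑ʳ opposite (opposite r))     ≡⟨ cong opposite (sym (opposite-↑ˡ (opposite r))) ⟩
  opposite (opposite (opposite r ↑ˡ N))     ≡⟨ FinP.opposite-involutive (opposite r ↑ˡ N) ⟩
  opposite r ↑ˡ N                           ∎
  where open ≡-Reasoning

opposite-≢ : ∀ {N} (a : Fin (N ℕ.+ N)) → opposite a ≢ a
opposite-≢ {N} a with block N N a
... | left  l = λ eq → ↑ˡ≢↑ʳ l (opposite l) (sym (trans (sym (opposite-↑ˡ l)) eq))
... | right r = λ eq → ↑ˡ≢↑ʳ (opposite r) r (trans (sym (opposite-↑ʳ r)) eq)

opposite-inject₁ : ∀ {m} (i : Fin m) → opposite (inject₁ i) ≡ suc (opposite i)
opposite-inject₁ {m} i = FinP.toℕ-injective (begin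
  toℕ (opposite (inject₁ i))        ≡⟨ FinP.opposite-prop (inject₁ i) ⟩
  m ∸ toℕ (inject₁ i)               ≡⟨ cong (m ∸_) (FinP.toℕ-inject₁ i) ⟩
  m ∸ toℕ i                         ≡⟨ ℕP.+-∸-assoc 1 (FinP.toℕ<n i) ⟩
  suc (m ∸ suc (toℕ i))             ≡⟨ cong suc (sym (FinP.opposite-prop i)) ⟩
  suc (toℕ (opposite i))            ∎)
  where open ≡-Reasoning

opposite-fromℕ : ∀ m → opposite (fromℕ m) ≡ zero
opposite-fromℕ zero    = refl
opposite-fromℕ (suc m) = cong inject₁ (opposite-fromℕ m)

idMat-opposite : ∀ {n} (a b : Fin n) → idMat a (opposite b) ≡ idMat (opposite a) b
idMat-opposite a b = idMat-cong (λ a≡b′ → trans (cong opposite a≡b′) (FinP.opposite-involutive b))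
                                (λ a′≡b → trans (sym (FinP.opposite-involutive a)) (cong opposite a′≡b))

J-δ : ∀ N (i l : Fin N) → J N i l ≡ δ (toℕ i ℕ.+ toℕ l) (N ∸ 1)
J-δ N i l with (toℕ i ℕ.+ toℕ l) ℕ.≟ (N ∸ 1)
... | yes i+l≡N-1 = sym (δ-≡ i+l≡N-1)
... | no  i+l≢N-1 = sym (δ-≢ i+l≢N-1)

J-opposite : ∀ N (i l : Fin N) → J N i l ≡ idMat i (opposite l)
J-opposite N i l = trans (J-δ N i l) (trans (δ-cong to from) (sym (idMat-δ i (opposite l))))
  where
  open ≡-Reasoning
  N-1-l≡opposite : (N ∸ 1) ∸ toℕ l ≡ toℕ (opposite l)
  N-1-l≡opposite = trans (ℕP.∸-+-assoc N 1 (toℕ l)) (sym (FinP.opposite-prop l))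
  to : toℕ i ℕ.+ toℕ l ≡ N ∸ 1 → toℕ i ≡ toℕ (opposite l)
  to i+l≡N-1 = begin
    toℕ i                        ≡⟨ sym (ℕP.m+n∸n≡m (toℕ i) (toℕ l)) ⟩
    (toℕ i ℕ.+ toℕ l) ∸ toℕ l    ≡⟨ cong (_∸ toℕ l) i+l≡N-1 ⟩
    (N ∸ 1) ∸ toℕ l              ≡⟨ N-1-l≡opposite ⟩
    toℕ (opposite l)             ∎
  from : toℕ i ≡ toℕ (opposite l) → toℕ i ℕ.+ toℕ l ≡ N ∸ 1
  from i≡opposite = begin
    toℕ i ℕ.+ toℕ l                ≡⟨ cong (ℕ._+ toℕ l) (trans i≡opposite (sym N-1-l≡opposite)) ⟩
    ((N ∸ 1) ∸ toℕ l) ℕ.+ toℕ l    ≡⟨ ℕP.m∸n+n≡m (ℕP.∸-monoˡ-≤ 1 (FinP.toℕ<n l)) ⟩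
    N ∸ 1                          ∎

J-row : ∀ M (c b : Fin M) → J M c b ≡ idMat (opposite c) b
J-row M c b = trans (J-opposite M c b) (idMat-opposite c b)

J·-row : ∀ {M p} (X : Mat M p) c b → (J M · X) c b ≡ X (opposite c) b
J·-row {M} X c = row-select₁ (J M) X c (opposite c) (J-row M c)

col : ∀ N → Fin (N ℕ.+ N) → Fin N
col N a = [ opposite , id ]′ (splitAt N a)

Q-col : ∀ N (i : Fin N) a → Q N i a ≡ idMat i (col N a)
Q-col N i a with splitAt N a
... | inj₁ l = J-opposite N i l
... | inj₂ r = refl

col-↑ˡ : ∀ {N} (l : Fin N) → col N (l ↑ˡ N) ≡ opposite l
col-↑ˡ {N} l rewrite FinP.splitAt-↑ˡ N l N = refl

col-↑ʳ : ∀ {N} (r : Fin N) → col N (N ↑ʳ r) ≡ r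
col-↑ʳ {N} r rewrite FinP.splitAt-↑ʳ N N r = refl

col-opposite : ∀ {N} (a : Fin (N ℕ.+ N)) → col N (opposite a) ≡ col N a
col-opposite {N} a with block N N a
... | left l = begin
  col N (opposite (l ↑ˡ N))   ≡⟨ cong (col N) (opposite-↑ˡ l) ⟩
  col N (N ↑ʳ opposite l)     ≡⟨ col-↑ʳ (opposite l) ⟩
  opposite l                  ≡⟨ sym (col-↑ˡ l) ⟩
  col N (l ↑ˡ N)              ∎
  where open ≡-Reasoning
... | right r = begin
  col N (opposite (N ↑ʳ r))   ≡⟨ cong (col N) (opposite-↑ʳ r) ⟩
  col N (opposite r ↑ˡ N)     ≡⟨ col-↑ˡ (opposite r) ⟩
  opposite (opposite r)       ≡⟨ FinP.opposite-involutive r ⟩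
  r                           ≡⟨ sym (col-↑ʳ r) ⟩
  col N (N ↑ʳ r)              ∎
  where open ≡-Reasoning

col-fibre : ∀ {N} (a b : Fin (N ℕ.+ N)) → col N a ≡ col N b → b ≡ a ⊎ b ≡ opposite a
col-fibre {N} a b eq with block N N a | block N N b
... | left l  | left l′  = inj₁ (cong (_↑ˡ N) (sym (opposite-injective l≡l′)))
  where
  l≡l′ : opposite l ≡ opposite l′
  l≡l′ = trans (sym (col-↑ˡ l)) (trans eq (col-↑ˡ l′))
... | left l  | right r′ = inj₂ (trans (cong (N ↑ʳ_) (sym l≡r′)) (sym (opposite-↑ˡ l)))
  where
  l≡r′ : opposite l ≡ r′
  l≡r′ = trans (sym (col-↑ˡ l)) (trans eq (col-↑ʳ r′))
... | right r | left l′  = inj₂ (trans (cong (_↑ˡ N) l′≡r) (sym (opposite-↑ʳ r)))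
  where
  l′≡r : l′ ≡ opposite r
  l′≡r = trans (sym (FinP.opposite-involutive l′))
               (cong opposite (sym (trans (sym (col-↑ʳ r)) (trans eq (col-↑ˡ l′)))))
... | right r | right r′ = inj₁ (cong (N ↑ʳ_) (sym r≡r′))
  where
  r≡r′ : r ≡ r′
  r≡r′ = trans (sym (col-↑ʳ r)) (trans eq (col-↑ʳ r′))

col-δ : ∀ {N} (a b : Fin (N ℕ.+ N)) → idMat (col N a) (col N b) ≡ idMat a b + idMat (opposite a) b
col-δ {N} a b with a Fin.≟ b | opposite a Fin.≟ b
... | yes refl | _        = begin
  idMat (col N a) (col N a)           ≡⟨ idMat-refl (col N a) ⟩
  1ℤ                                  ≡⟨ sym (cong₂ _+_ (idMat-refl a) (idMat-≢ (opposite-≢ {N} a))) ⟩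
  idMat a a + idMat (opposite a) a    ∎
  where open ≡-Reasoning
... | no a≢b   | yes refl = begin
  idMat (col N a) (col N (opposite a))          ≡⟨ cong (idMat (col N a)) (col-opposite a) ⟩
  idMat (col N a) (col N a)                     ≡⟨ idMat-refl (col N a) ⟩
  1ℤ                                            ≡⟨ sym (cong₂ _+_ (idMat-≢ a≢b) (idMat-refl (opposite a))) ⟩
  idMat a (opposite a) + idMat (opposite a) (opposite a) ∎
  where open ≡-Reasoning
... | no a≢b   | no a′≢b  = begin
  idMat (col N a) (col N b)             ≡⟨ idMat-≢ col≢ ⟩
  0ℤ                                    ≡⟨ sym (cong₂ _+_ (idMat-≢ a≢b) (idMat-≢ a′≢b)) ⟩
  idMat a b + idMat (opposite a) b      ∎
  where
  open ≡-Reasoning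
  col≢ : col N a ≢ col N b
  col≢ eq with col-fibre a b eq
  ... | inj₁ b≡a  = a≢b (sym b≡a)
  ... | inj₂ b≡a′ = a′≢b (sym b≡a′)

twoI-idMat : ∀ {n} (i j : Fin n) → idMat j i + idMat j i ≡ twoI i j
twoI-idMat i j with toℕ i ℕ.≟ toℕ j
... | yes i≡j = cong₂ _+_ [j≡i] [j≡i]
  where
  [j≡i] : idMat j i ≡ 1ℤ
  [j≡i] = trans (idMat-δ j i) (δ-≡ (sym i≡j))
... | no  i≢j = cong₂ _+_ [j≡i] [j≡i]
  where
  [j≡i] : idMat j i ≡ 0ℤ
  [j≡i] = trans (idMat-δ j i) (δ-≢ (λ j≡i → i≢j (sym j≡i)))

QQᵀ≈2I : ∀ N → Q N · Q N ᵀ ≈ twoI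
QQᵀ≈2I N .at i j = begin
  (Q N · Q N ᵀ) i j                                  ≡⟨ row-select₂ (Q N) (Q N ᵀ) i c (opposite c) row j ⟩
  Q N j c + Q N j (opposite c)                       ≡⟨ cong₂ _+_ (Q-col N j c) (Q-col N j (opposite c)) ⟩
  idMat j (col N c) + idMat j (col N (opposite c))   ≡⟨ cong (λ x → idMat j (col N c) + idMat j x) (col-opposite {N} c) ⟩
  idMat j (col N c) + idMat j (col N c)              ≡⟨ cong (λ x → idMat j x + idMat j x) (col-↑ʳ i) ⟩
  idMat j i + idMat j i                              ≡⟨ twoI-idMat i j ⟩
  twoI i j                                           ∎
  where
  open ≡-Reasoning
  -- row i of Q_N has its ones in column c = N + i and in its reversal
  c : Fin (N ℕ.+ N)
  c = N ↑ʳ i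
  row : ∀ a → Q N i a ≡ idMat c a + idMat (opposite c) a
  row a = trans (Q-col N i a) (trans (cong (λ x → idMat x (col N a)) (sym (col-↑ʳ i))) (col-δ c a))

QᵀQ≈I+J : ∀ N → Q N ᵀ · Q N ≈ idMat ⊕ J (N ℕ.+ N)
QᵀQ≈I+J N .at a b = begin
  (Q N ᵀ · Q N) a b                  ≡⟨ row-select₁ (Q N ᵀ) (Q N) a (col N a) (λ l → trans (Q-col N l a) (idMat-sym l (col N a))) b ⟩
  Q N (col N a) b                    ≡⟨ Q-col N (col N a) b ⟩
  idMat (col N a) (col N b)          ≡⟨ col-δ a b ⟩
  idMat a b + idMat (opposite a) b   ≡⟨ cong (idMat a b +_) (sym (J-row (N ℕ.+ N) a b)) ⟩
  idMat a b + J (N ℕ.+ N) a b        ∎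
  where open ≡-Reasoning

QJ≈Q : ∀ N → Q N · J (N ℕ.+ N) ≈ Q N
QJ≈Q N .at i b = begin
  (Q N · J (N ℕ.+ N)) i b         ≡⟨ column-select (Q N) (J (N ℕ.+ N)) b (opposite b) column i ⟩
  Q N i (opposite b)              ≡⟨ Q-col N i (opposite b) ⟩
  idMat i (col N (opposite b))    ≡⟨ cong (idMat i) (col-opposite {N} b) ⟩
  idMat i (col N b)               ≡⟨ sym (Q-col N i b) ⟩
  Q N i b                         ∎
  where
  open ≡-Reasoning
  column : ∀ l → J (N ℕ.+ N) l b ≡ idMat (opposite b) l
  column l = trans (J-opposite (N ℕ.+ N) l b) (idMat-sym l (opposite b))

σ-suc : ∀ n ε (a : Fin (n ℕ.+ suc n)) l → σ (suc n) ε (suc a) l ≡ idMat (inject₁ a) l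
σ-suc n ε a l with suc (toℕ a) ℕ.≟ suc (toℕ l)
... | yes a+1≡l+1 = sym (trans (idMat-δ (inject₁ a) l) (δ-≡ (trans (FinP.toℕ-inject₁ a) (ℕP.suc-injective a+1≡l+1))))
... | no  a+1≢l+1 = sym (idMat-≢ (λ a≡l → a+1≢l+1 (cong suc (trans (sym (FinP.toℕ-inject₁ a)) (cong toℕ a≡l)))))

σ-zero : ∀ n ε l → σ (suc n) ε zero l ≡ ε * idMat (fromℕ (n ℕ.+ suc n)) l
σ-zero n ε l with toℕ l ℕ.≟ n ℕ.+ suc n
... | yes l≡last = sym (trans (cong (ε *_) (trans (idMat-δ (fromℕ _) l) (δ-≡ (trans (FinP.toℕ-fromℕ _) (sym l≡last)))))
                                 (ℤP.*-identityʳ ε))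
... | no  l≢last = sym (trans (cong (ε *_) (idMat-≢ (λ last≡l → l≢last (sym (trans (sym (FinP.toℕ-fromℕ _)) (cong toℕ last≡l))))))
                             (ℤP.*-zeroʳ ε))

-- σ_{2N}(ε) J_{2N} σ_{2N}(ε) = J_{2N} when ε² = 1: conjugating the cyclic
-- shift by the reversal inverts it.
σJσ≈J : ∀ n ε → ε * ε ≡ 1ℤ → σ (suc n) ε · (J (suc n ℕ.+ suc n) · σ (suc n) ε) ≈ J (suc n ℕ.+ suc n)
σJσ≈J n ε ε²≡1 .at (suc a) b = begin
  (S · (R · S)) (suc a) b          ≡⟨ row-select₁ S (R · S) (suc a) (inject₁ a) (σ-suc n ε a) b ⟩
  (R · S) (inject₁ a) b            ≡⟨ J·-row S (inject₁ a) b ⟩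
  S (opposite (inject₁ a)) b       ≡⟨ cong (λ x → S x b) (opposite-inject₁ a) ⟩
  S (suc (opposite a)) b           ≡⟨ σ-suc n ε (opposite a) b ⟩
  idMat (opposite (suc a)) b       ≡⟨ J-row _ (suc a) b ⟨
  R (suc a) b                      ∎
  where
  open ≡-Reasoning
  S R : Mat (suc n ℕ.+ suc n) (suc n ℕ.+ suc n)
  S = σ (suc n) ε
  R = J (suc n ℕ.+ suc n)
σJσ≈J n ε ε²≡1 .at zero b = begin
  (S · (R · S)) zero b             ≡⟨ row-select S (R · S) zero last ε (σ-zero n ε) b ⟩
  ε * (R · S) last b               ≡⟨ cong (ε *_) (J·-row S last b) ⟩
  ε * S (opposite last) b          ≡⟨ cong (λ x → ε * S x b) (opposite-fromℕ (n ℕ.+ suc n)) ⟩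
  ε * S zero b                     ≡⟨ cong (ε *_) (σ-zero n ε b) ⟩
  ε * (ε * idMat last b)           ≡⟨ ℤP.*-assoc ε ε (idMat last b) ⟨
  (ε * ε) * idMat last b           ≡⟨ cong (_* idMat last b) ε²≡1 ⟩
  1ℤ * idMat last b                ≡⟨ ℤP.*-identityˡ (idMat last b) ⟩
  idMat (opposite zero) b          ≡⟨ J-row _ zero b ⟨
  R zero b                         ∎
  where
  open ≡-Reasoning
  S R : Mat (suc n ℕ.+ suc n) (suc n ℕ.+ suc n)
  S = σ (suc n) ε
  R = J (suc n ℕ.+ suc n)
  last : Fin (suc n ℕ.+ suc n)
  last = fromℕ (n ℕ.+ suc n)

QσQᵀ : ∀ N → ℤ → ℕ → Mat N N
QσQᵀ N ε k = Q N · pow (σ N ε) k · (Q N ᵀ)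

QσQᵀ-initial : ∀ N ε → QσQᵀ N ε 0 ≈ twoI
QσQᵀ-initial N ε .at i j = trans (·-congˡ (Q N ᵀ) (·-identityʳ (Q N)) .at i j) (QQᵀ≈2I N .at i j)

QσQᵀ-recurrence : ∀ n ε → ε * ε ≡ 1ℤ → ∀ k (i j : Fin (suc n)) →
  QσQᵀ (suc n) ε (2 ℕ.+ k) i j ≡ (QσQᵀ (suc n) ε 1 · QσQᵀ (suc n) ε (1 ℕ.+ k)) i j - QσQᵀ (suc n) ε k i j
QσQᵀ-recurrence n ε ε²≡1 k i j = y≡x-z (begin
  (A 1 · A (1 ℕ.+ k)) i j                      ≡⟨ ·-congˡ (A (1 ℕ.+ k)) A₁≈QSQᵀ .at i j ⟩
  (((Q′ · S) · Q′ ᵀ) · A (1 ℕ.+ k)) i j        ≡⟨ chebyshev-recurrence Q′ (Q′ ᵀ) S key k .at i j ⟩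
  A (2 ℕ.+ k) i j + A k i j                    ∎)
  where
  open ≡-Reasoning
  N : ℕ
  N = suc n
  Q′ : Mat N (N ℕ.+ N)
  Q′ = Q N
  S : Mat (N ℕ.+ N) (N ℕ.+ N)
  S = σ N ε
  A : ℕ → Mat N N
  A = QσQᵀ N ε
  A₁≈QSQᵀ : A 1 ≈ (Q′ · S) · Q′ ᵀ
  A₁≈QSQᵀ = ·-congˡ (Q′ ᵀ) (·-congʳ Q′ (·-identityʳ S))
  key : ((Q′ · S) · Q′ ᵀ) · (Q′ · S) ≈ (Q′ · S) · S ⊕ Q′
  key = key-identity Q′ (Q′ ᵀ) S (J (N ℕ.+ N)) (QᵀQ≈I+J N) (σJσ≈J n ε ε²≡1) (QJ≈Q N)
  y≡x-z : ∀ {x y z} → x ≡ y + z → y ≡ x - z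
  y≡x-z {y = y} {z} refl = solve 2 (λ y z → y := (y :+ z) :- z) refl y z

sumUpTo-zero : ∀ n (f : ℕ → ℤ) → (∀ l → l < n → f l ≡ 0ℤ) → sumUpTo n f ≡ 0ℤ
sumUpTo-zero zero    f f≡0 = refl
sumUpTo-zero (suc n) f f≡0 =
  cong₂ _+_ (sumUpTo-zero n f (λ l l<n → f≡0 l (ℕP.m≤n⇒m≤1+n l<n))) (f≡0 n ℕP.≤-refl)

sumUpTo-δ : ∀ n c (f : ℕ → ℤ) → c < n → sumUpTo n (λ l → δ c l * f l) ≡ f c
sumUpTo-δ (suc n) c f c<1+n with ℕP.m≤n⇒m<n∨m≡n (ℕ.s≤s⁻¹ c<1+n)
... | inj₁ c<n = begin
  sumUpTo n (λ l → δ c l * f l) + δ c n * f n ≡⟨ cong₂ _+_ (sumUpTo-δ n c f c<n) (cong (_* f n) (δ-≢ (ℕP.<⇒≢ c<n))) ⟩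
  f c + 0ℤ * f n                              ≡⟨ trans (cong (f c +_) (ℤP.*-zeroˡ (f n))) (ℤP.+-identityʳ (f c)) ⟩
  f c                                         ∎
  where open ≡-Reasoning
... | inj₂ refl = begin
  sumUpTo n (λ l → δ c l * f l) + δ c c * f c ≡⟨ cong₂ _+_ (sumUpTo-zero n _ below) (cong (_* f c) (δ-refl c)) ⟩
  0ℤ + 1ℤ * f c                               ≡⟨ trans (ℤP.+-identityˡ (1ℤ * f c)) (ℤP.*-identityˡ (f c)) ⟩
  f c                                         ∎
  where
  open ≡-Reasoning
  below : ∀ l → l < c → δ c l * f l ≡ 0ℤ
  below l l<c = cong (_* f l) (δ-≢ (λ c≡l → ℕP.<⇒≢ l<c (sym c≡l)))

sumUpTo-cong : ∀ n {f g : ℕ → ℤ} → (∀ l → f l ≡ g l) → sumUpTo n f ≡ sumUpTo n g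
sumUpTo-cong zero    f≗g = refl
sumUpTo-cong (suc n) f≗g = cong₂ _+_ (sumUpTo-cong n f≗g) (f≗g n)

sumUpTo-+ : ∀ n (f g : ℕ → ℤ) → sumUpTo n (λ l → f l + g l) ≡ sumUpTo n f + sumUpTo n g
sumUpTo-+ zero    f g = refl
sumUpTo-+ (suc n) f g = trans (cong (_+ (f n + g n)) (sumUpTo-+ n f g))
  (solve 4 (λ a b c d → (a :+ b) :+ (c :+ d) := (a :+ c) :+ (b :+ d)) refl
    (sumUpTo n f) (sumUpTo n g) (f n) (g n))

imul-two-units : ∀ (A : RowFinite) (X : IMat) i a b → a < bound A i → b < bound A i →
                 (∀ l → entry A i l ≡ δ a l + δ b l) → ∀ j → imul A X i j ≡ X a j + X b j
imul-two-units A X i a b a< b< row j = begin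
  sumUpTo (bound A i) (λ l → entry A i l * X l j)
    ≡⟨ sumUpTo-cong (bound A i) (λ l → trans (cong (_* X l j) (row l)) (ℤP.*-distribʳ-+ (X l j) (δ a l) (δ b l))) ⟩
  sumUpTo (bound A i) (λ l → δ a l * X l j + δ b l * X l j)
    ≡⟨ sumUpTo-+ (bound A i) _ _ ⟩
  sumUpTo (bound A i) (λ l → δ a l * X l j) + sumUpTo (bound A i) (λ l → δ b l * X l j)
    ≡⟨ cong₂ _+_ (sumUpTo-δ _ a (λ l → X l j) a<) (sumUpTo-δ _ b (λ l → X l j) b<) ⟩
  X a j + X b j ∎
  where open ≡-Reasoning

-- Closed formula for the entries of γ^(k), valid for every k ≥ 0 (for k = 0
-- the first two terms together give 2[i = j] and the last one vanishes):
--   γ^(k)(i,j) = [i = k + j] + [j = k + i] + [i + j + 1 = k].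
gammaFormula : ℕ → ℕ → ℕ → ℤ
gammaFormula k i j = δ i (k ℕ.+ j) + δ j (k ℕ.+ i) + δ (suc (i ℕ.+ j)) k

δ-distance : ∀ k i j → δ i (suc (k ℕ.+ j)) + δ j (suc (k ℕ.+ i)) ≡ δ ∣ i - j ∣ (suc k)
δ-distance k zero    j       = trans (ℤP.+-identityˡ _) (cong (λ m → δ j (suc m)) (ℕP.+-identityʳ k))
δ-distance k (suc i) zero    = trans (ℤP.+-identityʳ _) (cong (δ i) (ℕP.+-identityʳ k))
δ-distance k (suc i) (suc j) =
  trans (cong₂ _+_ (cong (δ i) (ℕP.+-suc k j)) (cong (δ j) (ℕP.+-suc k i))) (δ-distance k i j)

-- |i - j| ≤ i + j, so |i - j| = k + 1 and i + j = k exclude each other.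
∣-∣≤+ : ∀ i j → ∣ i - j ∣ ≤ i ℕ.+ j
∣-∣≤+ i j = ℕP.≤-trans (ℕP.∣m-n∣≤m⊔n i j) (ℕP.m⊔n≤m+n i j)

gammaK-formula : ∀ k i j → gammaK k i j ≡ gammaFormula k i j
gammaK-formula zero i j with i ℕ.≟ j
... | yes refl = sym (trans (ℤP.+-identityʳ _) (cong₂ _+_ (δ-refl i) (δ-refl i)))
... | no  i≢j  = sym (trans (ℤP.+-identityʳ _) (cong₂ _+_ (δ-≢ i≢j) (δ-≢ (λ j≡i → i≢j (sym j≡i)))))
gammaK-formula (suc k) i j with ∣ i - j ∣ ℕ.≟ suc k | (i ℕ.+ j) ℕ.≟ k
... | yes d | _     = sym (cong₂ _+_ (trans (δ-distance k i j) (δ-≡ d)) (δ-≢ i+j≢k))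
  where
  i+j≢k : i ℕ.+ j ≢ k
  i+j≢k i+j≡k = ℕP.<-irrefl refl (ℕP.≤-trans (ℕP.≤-reflexive (sym d)) (ℕP.≤-trans (∣-∣≤+ i j) (ℕP.≤-reflexive i+j≡k)))
... | no ¬d | yes e = sym (cong₂ _+_ (trans (δ-distance k i j) (δ-≢ ¬d)) (δ-≡ e))
... | no ¬d | no ¬e = sym (cong₂ _+_ (trans (δ-distance k i j) (δ-≢ ¬d)) (δ-≢ ¬e))

γX-row₀ : ∀ X j → imul gamma X 0 j ≡ X 0 j + X 1 j
γX-row₀ X = imul-two-units gamma X 0 0 1 (s≤s z≤n) (s≤s (s≤s z≤n)) row₀
  where
  row₀ : ∀ l → gammaK 1 0 l ≡ δ 0 l + δ 1 l
  row₀ l = begin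
    gammaK 1 0 l           ≡⟨ gammaK-formula 1 0 l ⟩
    0ℤ + δ l 1 + δ l 0     ≡⟨ cong₂ _+_ (trans (ℤP.+-identityˡ _) (δ-sym l 1)) (δ-sym l 0) ⟩
    δ 1 l + δ 0 l          ≡⟨ ℤP.+-comm (δ 1 l) (δ 0 l) ⟩
    δ 0 l + δ 1 l          ∎
    where open ≡-Reasoning

γX-rowₛ : ∀ X i j → imul gamma X (suc i) j ≡ X i j + X (suc (suc i)) j
γX-rowₛ X i = imul-two-units gamma X (suc i) i (suc (suc i))
  (ℕP.m≤n⇒m≤1+n (ℕP.m≤n⇒m≤1+n (ℕP.n<1+n i))) ℕP.≤-refl rowₛ
  where
  rowₛ : ∀ l → gammaK 1 (suc i) l ≡ δ i l + δ (suc (suc i)) l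
  rowₛ l = begin
    gammaK 1 (suc i) l              ≡⟨ gammaK-formula 1 (suc i) l ⟩
    δ i l + δ l (suc (suc i)) + 0ℤ  ≡⟨ ℤP.+-identityʳ _ ⟩
    δ i l + δ l (suc (suc i))       ≡⟨ cong (δ i l +_) (δ-sym l (suc (suc i))) ⟩
    δ i l + δ (suc (suc i)) l       ∎
    where open ≡-Reasoning

formula-recurrence₀ : ∀ k j →
  gammaFormula (2 ℕ.+ k) 0 j ≡ (gammaFormula (1 ℕ.+ k) 0 j + gammaFormula (1 ℕ.+ k) 1 j) - gammaFormula k 0 j
formula-recurrence₀ k j rewrite ℕP.+-suc k 0 | ℕP.+-identityʳ k =
  solve 5 (λ x y z p q → con 0ℤ :+ z :+ y := ((con 0ℤ :+ y :+ x) :+ (p :+ z :+ q)) :- (p :+ x :+ q)) refl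
    (δ j k) (δ j (suc k)) (δ j (suc (suc k))) (δ 0 (k ℕ.+ j)) (δ (suc j) k)

formula-recurrenceₛ : ∀ k i j →
  gammaFormula (2 ℕ.+ k) (suc i) j ≡ (gammaFormula (1 ℕ.+ k) i j + gammaFormula (1 ℕ.+ k) (suc (suc i)) j) - gammaFormula k (suc i) j
formula-recurrenceₛ k i j rewrite ℕP.+-suc k (suc i) | ℕP.+-suc k i =
  solve 6 (λ a b c p r t → a :+ r :+ c := ((a :+ b :+ c) :+ (p :+ r :+ t)) :- (p :+ b :+ t)) refl
    (δ i (suc (k ℕ.+ j))) (δ j (suc (k ℕ.+ i))) (δ (i ℕ.+ j) k)
    (δ (suc i) (k ℕ.+ j)) (δ j (suc (suc (suc (k ℕ.+ i))))) (δ (suc (suc (i ℕ.+ j))) k)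

gamma-recurrence : ∀ k i j → gammaK (2 ℕ.+ k) i j ≡ imul gamma (gammaK (1 ℕ.+ k)) i j - gammaK k i j
gamma-recurrence k zero j = begin
  gammaK (2 ℕ.+ k) 0 j
    ≡⟨ gammaK-formula (2 ℕ.+ k) 0 j ⟩
  gammaFormula (2 ℕ.+ k) 0 j
    ≡⟨ formula-recurrence₀ k j ⟩
  (gammaFormula (1 ℕ.+ k) 0 j + gammaFormula (1 ℕ.+ k) 1 j) - gammaFormula k 0 j
    ≡⟨ sym (cong₂ _-_ (cong₂ _+_ (gammaK-formula (1 ℕ.+ k) 0 j) (gammaK-formula (1 ℕ.+ k) 1 j)) (gammaK-formula k 0 j)) ⟩
  (gammaK (1 ℕ.+ k) 0 j + gammaK (1 ℕ.+ k) 1 j) - gammaK k 0 j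
    ≡⟨ cong (_- gammaK k 0 j) (sym (γX-row₀ (gammaK (1 ℕ.+ k)) j)) ⟩
  imul gamma (gammaK (1 ℕ.+ k)) 0 j - gammaK k 0 j ∎
  where open ≡-Reasoning
gamma-recurrence k (suc i) j = begin
  gammaK (2 ℕ.+ k) (suc i) j
    ≡⟨ gammaK-formula (2 ℕ.+ k) (suc i) j ⟩
  gammaFormula (2 ℕ.+ k) (suc i) j
    ≡⟨ formula-recurrenceₛ k i j ⟩
  (gammaFormula (1 ℕ.+ k) i j + gammaFormula (1 ℕ.+ k) (suc (suc i)) j) - gammaFormula k (suc i) j
    ≡⟨ sym (cong₂ _-_ (cong₂ _+_ (gammaK-formula (1 ℕ.+ k) i j) (gammaK-formula (1 ℕ.+ k) (suc (suc i)) j)) (gammaK-formula k (suc i) j)) ⟩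
  (gammaK (1 ℕ.+ k) i j + gammaK (1 ℕ.+ k) (suc (suc i)) j) - gammaK k (suc i) j
    ≡⟨ cong (_- gammaK k (suc i) j) (sym (γX-rowₛ (gammaK (1 ℕ.+ k)) i j)) ⟩
  imul gamma (gammaK (1 ℕ.+ k)) (suc i) j - gammaK k (suc i) j ∎
  where open ≡-Reasoning

from-two : ∀ {P : ℕ → Set} → (∀ k → P (2 ℕ.+ k)) → ∀ k → 2 ≤ k → P k
from-two p (suc (suc k)) (s≤s (s≤s z≤n)) = p k

theorem5p1 : (N : ℕ) → 1 ≤ N →
    -- δ = α_N
    ((∀ i j → alphaK N 1 i j ≡ alpha N i j)
      × (∀ i j → alphaK N 0 i j ≡ twoI i j)
      × (∀ k → 2 ≤ k → ∀ (i j : Fin N) →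
           alphaK N k i j ≡ (alpha N · alphaK N (k ∸ 1)) i j - alphaK N (k ∸ 2) i j))
    -- δ = β_N
    × ((∀ i j → betaK N 1 i j ≡ beta N i j)
      × (∀ i j → betaK N 0 i j ≡ twoI i j)
      × (∀ k → 2 ≤ k → ∀ (i j : Fin N) →
           betaK N k i j ≡ (beta N · betaK N (k ∸ 1)) i j - betaK N (k ∸ 2) i j))
    -- δ = γ
    × ((∀ i j → gammaK 1 i j ≡ entry gamma i j)
      × (∀ i j → gammaK 0 i j ≡ twoIinf i j)
      × (∀ k → 2 ≤ k → ∀ (i j : ℕ) →
           gammaK k i j ≡ imul gamma (gammaK (k ∸ 1)) i j - gammaK (k ∸ 2) i j))
theorem5p1 (suc n) (s≤s z≤n) =
    ((λ _ _ → refl) , QσQᵀ-initial (suc n) 1ℤ .at , from-two (QσQᵀ-recurrence n 1ℤ refl))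
  , ((λ _ _ → refl) , QσQᵀ-initial (suc n) (ℤ.- 1ℤ) .at , from-two (QσQᵀ-recurrence n (ℤ.- 1ℤ) refl))
  , ((λ _ _ → refl) , (λ _ _ → refl) , from-two gamma-recurrence)
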